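{- Let $\mathcal{M}=(n,Q,\Sigma,\Gamma,\Delta,q_0,\gamma_0,F)$ be an OMPA in normal form with $n>1$, and let $\mathcal{M}_{[1,n[}$ and $\mathcal{M}'$ be as defined in the context. For every $q,q'\in Q$ and $w_1,w_1',\dots,w_n,w_n'\in\mathit{Stack}(\mathcal{M})$: $(q,w_1,\dots,w_n)$ reaches $(q',w_1',\dots,w_n')$ by a finite sequence of steps of $\mathcal{M}_{[1,n[}$ (labelled by some $\tau\in\Sigma^*$) if and only if there is $u\in\Gamma^*$ such that $(q,w_1,\dots,w_{n-1})$ reaches $(q',w_1',\dots,w_{n-1}')$ by a finite sequence of steps of $\mathcal{M}'$ whose labels concatenate to $u$, and $w_n'=u^Rw_n$.
   Context: For a finite alphabet $X$, $X_\epsilon=X\cup\{\epsilon\}$; $u^R$ is the reversal of $u$. A multi-pushdown automaton (MPA) is $\mathcal{M}=(n,Q,\Sigma,\Gamma,\Delta,q_0,\gamma_0,F)$ with $n\ge1$ stacks, finite nonempty state set $Q$, finite input alphabet $\Sigma$, finite stack alphabet $\Gamma\ni\bot$, $q_0\in Q$, $\gamma_0\in\Gamma\setminus\{\bot\}$, $F\subseteq Q$, and $\Delta\subseteq(Q\times(\Gamma_\epsilon)^n)\times\Sigma_\epsilon\times(Q\times(\Gamma^*)^n)$ such that for each transition $((q,\gamma_1,\dots,\gamma_n),a,(q',\alpha_1,\dots,\alpha_n))$ and each $i$: $|\alpha_i|\le2$; if $\gamma_i\ne\bot$ then $\alpha_i\in(\Gamma\setminus\{\bot\})^*$; if $\gamma_i=\bot$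 then $\alpha_i=\alpha_i'\bot$ with $\alpha_i'\in(\Gamma\setminus\{\bot\})\cup\{\epsilon\}$. $\mathit{Stack}(\mathcal{M})=(\Gamma\setminus\{\bot\})^*\bot$; configurations are $(q,w_1,\dots,w_n)$ with $w_i\in\mathit{Stack}(\mathcal{M})$; each transition gives steps $(q,\gamma_1w_1,\dots,\gamma_nw_n)\xrightarrow{a}(q',\alpha_1w_1,\dots,\alpha_nw_n)$ whenever all $\gamma_iw_i\in\mathit{Stack}(\mathcal{M})$. An OMPA is an MPA where each transition has, for some $i$, $\gamma_1=\dots=\gamma_{i-1}=\bot$, $\gamma_i\in\Gamma_\epsilon$, $\gamma_{i+1}=\dots=\gamma_n=\epsilon$. Normal form: every transition is either (a) $((q,\gamma,\epsilon,\dots,\epsilon),a,(q',\alpha_1,\dots,\alpha_n))$ with $\gamma\in\Gamma$, $\alpha_1\in\Gamma^*$, $\alpha_j\in(\Gamma\setminus\{\bot\})\cup\{\epsilon\}$ for $j\ge2$, or (b) a transition popping $\gamma\in\Gamma\setminus\{\bot\}$ from stack $i\in[2,n]$ (stacks $1..i-1$ read $\bot$, the rest $\epsilon$) and producing $\gamma'\bot$ on stack 1 ($\gamma'\in\Gamma\setminus\{\bot\}$), $\bot$ on stacks $2..i-1$, $\epsilon$ on stacks $i..n$. $\mathcal{M}_{[1,n[}=(n,Q,\Sigma,\Gamma,\Delta_{[1,n[},q_0,\gamma_0,F)$ where $\Delta_{[1,n[}$ consists of the transitions of $\Delta$ whose $n$-th popped component is $\epsilon$ (no pop on stack $n$). $\mathcal{M}'=(n-1,Q,\Gamma,\Gamma,\Delta',q_0,\gamma_0,F)$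 is the $(n-1)$-OMPA with input alphabet $\Gamma$ whose transition relation $\Delta'$ is the smallest set such that whenever $((q,\gamma_1,\dots,\gamma_{n-1},\epsilon),a,(q',\alpha_1,\dots,\alpha_{n-1},\alpha_n))\in\Delta_{[1,n[}$, then $((q,\gamma_1,\dots,\gamma_{n-1}),\alpha_n,(q',\alpha_1,\dots,\alpha_{n-1}))\in\Delta'$ (the symbol pushed on stack $n$ becomes the input label). The configurations of $\mathcal{M}'$ are $(q,w_1,\dots,w_{n-1})$ with $w_i\in\mathit{Stack}(\mathcal{M})$. -}

module Defs where

open import Data.Nat using (ℕ; zero; suc; _≤_; _<_)
open import Data.Fin using (Fin; toℕ)
open import Data.Fin.Subset using (Subset)
open import Data.Vec using (Vec; lookup; init; last)
open import Data.List using (List; []; _∷_; _++_; length; reverse; fromMaybe)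
open import Data.List.Relation.Unary.All using (All)
open import Data.List.Membership.Propositional using (_∈_)
open import Data.Maybe using (Maybe; just; nothing)
open import Data.Product using (Σ; ∃; _×_; _,_)
open import Data.Sum using (_⊎_)
open import Relation.Binary.PropositionalEquality using (_≡_; _≢_)

-- Generic transitions over n stacks.
-- pop  i = nothing  means  γ_i = ε ;  pop i = just γ  means γ_i = γ.
-- push i = α_i.  The label has an arbitrary type L (Σ_ε for an MPA).

record Trans (n : ℕ) (Q G L : Set) : Set where
  constructor tr
  field
    src  : Q
    pop  : Vec (Maybe G) n
    lab  : L
    tgt  : Q
    push : Vec (List G) n
open Trans public

IsStack : {G : Set} → G → List G → Set
IsStack {G} bot w = Σ (List G) λ w′ → All (λ x → x ≢ bot) w′ × w ≡ w′ ++ (bot ∷ [])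

Step : {n : ℕ} {Q G L : Set} → G → Trans n Q G L →
       Q → Vec (List G) n → Q → Vec (List G) n → Set
Step {n} {Q} {G} bot t q ws q′ ws′ =
  q ≡ src t × q′ ≡ tgt t ×
  Σ (Vec (List G) n) λ rest → (i : Fin n) →
      lookup ws i ≡ fromMaybe (lookup (pop t) i) ++ lookup rest i
    × IsStack bot (lookup ws i)
    × lookup ws′ i ≡ lookup (push t) i ++ lookup rest i

data Reach {n : ℕ} {Q G L X : Set} (bot : G) (Δ : Trans n Q G L → Set)
           (word : L → List X) : Q → Vec (List G) n → List X → Q → Vec (List G) n → Set where
  done : ∀ {q ws} → Reach bot Δ word q ws [] q ws
  step : ∀ {q ws q₁ ws₁ u q₂ ws₂} (t : Trans n Q G L) → Δ t →
         Step bot t q ws q₁ ws₁ → Reach bot Δ word q₁ ws₁ u q₂ ws₂ →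
         Reach bot Δ word q ws (word (lab t) ++ u) q₂ ws₂

record MPA (n : ℕ) : Set where
  field
    nQ nΣ nΓ : ℕ
    bot    : Fin nΓ
    Δ      : List (Trans n (Fin nQ) (Fin nΓ) (Maybe (Fin nΣ)))
    q₀     : Fin nQ
    γ₀     : Fin nΓ
    γ₀≢bot : γ₀ ≢ bot
    F      : Subset nQ
open MPA public

Tr : {n : ℕ} → MPA n → Set
Tr {n} M = Trans n (Fin (nQ M)) (Fin (nΓ M)) (Maybe (Fin (nΣ M)))

WFTrans : {n : ℕ} (M : MPA n) → Tr M → Set
WFTrans {n} M t = (i : Fin n) →
    length (lookup (push t) i) ≤ 2
  × (lookup (pop t) i ≢ just (bot M) → All (λ x → x ≢ bot M) (lookup (push t) i))
  × (lookup (pop t) i ≡ just (bot M) →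
       Σ (Maybe (Fin (nΓ M))) λ a →
         All (λ x → x ≢ bot M) (fromMaybe a) × lookup (push t) i ≡ fromMaybe a ++ (bot M ∷ []))

IsMPA : {n : ℕ} → MPA n → Set
IsMPA M = ∀ t → t ∈ Δ M → WFTrans M t

OrderedTrans : {n : ℕ} (M : MPA n) → Tr M → Set
OrderedTrans {n} M t = Σ (Fin n) λ i → (j : Fin n) →
    (toℕ j < toℕ i → lookup (pop t) j ≡ just (bot M))
  × (toℕ i < toℕ j → lookup (pop t) j ≡ nothing)

IsOMPA : {n : ℕ} → MPA n → Set
IsOMPA M = IsMPA M × (∀ t → t ∈ Δ M → OrderedTrans M t)

NFa : {n : ℕ} (M : MPA n) → Tr M → Set
NFa {n} M t = (j : Fin n) →
    (toℕ j ≡ 0 → Σ (Fin (nΓ M)) λ γ → lookup (pop t) j ≡ just γ)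
  × (1 ≤ toℕ j → lookup (pop t) j ≡ nothing
                × length (lookup (push t) j) ≤ 1
                × All (λ x → x ≢ bot M) (lookup (push t) j))

NFb : {n : ℕ} (M : MPA n) → Tr M → Set
NFb {n} M t = Σ (Fin n) λ i → 1 ≤ toℕ i
  × (Σ (Fin (nΓ M)) λ γ → γ ≢ bot M × lookup (pop t) i ≡ just γ)
  × (Σ (Fin (nΓ M)) λ γ′ → γ′ ≢ bot M ×
      ((j : Fin n) → toℕ j ≡ 0 → lookup (push t) j ≡ γ′ ∷ bot M ∷ []))
  × ((j : Fin n) →
       (toℕ j < toℕ i → lookup (pop t) j ≡ just (bot M))
     × (toℕ i < toℕ j → lookup (pop t) j ≡ nothing)
     × (1 ≤ toℕ j → toℕ j < toℕ i → lookup (push t) j ≡ bot M ∷ [])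
     × (toℕ i ≤ toℕ j → lookup (push t) j ≡ []))

NormalForm : {n : ℕ} → MPA n → Set
NormalForm M = ∀ t → t ∈ Δ M → NFa M t ⊎ NFb M t

Stacks : {n : ℕ} → MPA n → Set
Stacks {n} M = Vec (List (Fin (nΓ M))) n

Δ[1,n[ : {n : ℕ} (M : MPA (suc n)) → Tr M → Set
Δ[1,n[ M t = t ∈ Δ M × last (pop t) ≡ nothing

ReachSub : {n : ℕ} (M : MPA (suc n)) →
  Fin (nQ M) → Stacks M → List (Fin (nΣ M)) → Fin (nQ M) → Stacks M → Set
ReachSub M = Reach (bot M) (Δ[1,n[ M) fromMaybe

-- M' : (n-1) stacks, input alphabet Γ; the label of the new transition is α_n
-- (a word over Γ; of length ≤ 1 for OMPA in normal form).
restrict : {n : ℕ} (M : MPA (suc n)) → Tr M →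
  Trans n (Fin (nQ M)) (Fin (nΓ M)) (List (Fin (nΓ M)))
restrict M t = tr (src t) (init (pop t)) (last (push t)) (tgt t) (init (push t))

Δ′ : {n : ℕ} (M : MPA (suc n)) →
  Trans n (Fin (nQ M)) (Fin (nΓ M)) (List (Fin (nΓ M))) → Set
Δ′ M t′ = Σ (Tr M) λ t → Δ[1,n[ M t × t′ ≡ restrict M t

ReachPrime : {n : ℕ} (M : MPA (suc n)) →
  Fin (nQ M) → Vec (List (Fin (nΓ M))) n → List (Fin (nΓ M)) →
  Fin (nQ M) → Vec (List (Fin (nΓ M))) n → Set
ReachPrime M = Reach (bot M) (Δ′ M) (λ w → w)

-- Transitions of M_[1,n[ never pop stack n, and in normal form they push at most one
-- non-⊥ symbol on it.  So stack n is write-only: a run of M_[1,n[ is a run of the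
-- first n-1 stacks together with the word u of symbols written on stack n, which ends
-- up on that stack reversed, and M′ is exactly the automaton reading u as its input.
module Submission where

open import Defs
open import Data.Nat using (ℕ; suc; zero; _≤_; z≤n; s≤s)
open import Data.Fin using (Fin; fromℕ; inject₁)
open import Data.Fin.Properties using (≤fromℕ)
open import Data.Fin.Relation.Unary.Top using (view; ‵fromℕ; ‵inject₁)
open import Data.Vec using (Vec; lookup; init; last; _∷ʳ_) renaming (_∷_ to _∷ᵥ_; [] to []ᵥ)
open import Data.List using (List; []; _∷_; _++_; [_]; reverse; fromMaybe; length)
open import Data.List.Properties using (++-assoc; ++-identityʳ; unfold-reverse)
open import Data.List.Relation.Unary.All using (All; [])
open import Data.List.Relation.Unary.All.Properties using (++⁺)
open import Data.Maybe using (Maybe; nothing)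
open import Data.Product using (Σ; ∃; _×_; _,_)
open import Data.Sum using (inj₁; inj₂)
open import Function using (id)
open import Relation.Binary.PropositionalEquality
  using (_≡_; _≢_; refl; sym; trans; cong; subst; subst₂; module ≡-Reasoning)

private
  variable
    A : Set
    n : ℕ

lookup-inject₁-init : (v : Vec A (suc n)) (j : Fin n) → lookup v (inject₁ j) ≡ lookup (init v) j
lookup-inject₁-init (x ∷ᵥ v) Fin.zero    = refl
lookup-inject₁-init (x ∷ᵥ v) (Fin.suc j) = lookup-inject₁-init v j

lookup-fromℕ-last : (v : Vec A (suc n)) → lookup v (fromℕ n) ≡ last v
lookup-fromℕ-last {n = zero}  (x ∷ᵥ []ᵥ) = refl
lookup-fromℕ-last {n = suc n} (x ∷ᵥ v)   = lookup-fromℕ-last v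

lookup-∷ʳ-inject₁ : (v : Vec A n) (x : A) (j : Fin n) → lookup (v ∷ʳ x) (inject₁ j) ≡ lookup v j
lookup-∷ʳ-inject₁ (y ∷ᵥ v) x Fin.zero    = refl
lookup-∷ʳ-inject₁ (y ∷ᵥ v) x (Fin.suc j) = lookup-∷ʳ-inject₁ v x j

lookup-∷ʳ-fromℕ : (v : Vec A n) (x : A) → lookup (v ∷ʳ x) (fromℕ n) ≡ x
lookup-∷ʳ-fromℕ []ᵥ       x = refl
lookup-∷ʳ-fromℕ (y ∷ᵥ v) x = lookup-∷ʳ-fromℕ v x

init-∷ʳ-last : (v : Vec A (suc n)) → init v ∷ʳ last v ≡ v
init-∷ʳ-last {n = zero}  (x ∷ᵥ []ᵥ) = refl
init-∷ʳ-last {n = suc n} (x ∷ᵥ v)   = cong (x ∷ᵥ_) (init-∷ʳ-last v)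

reverse-++-short : (α u : List A) → length α ≤ 1 → reverse (α ++ u) ≡ reverse u ++ α
reverse-++-short []      u _ = sym (++-identityʳ (reverse u))
reverse-++-short (x ∷ []) u _ = unfold-reverse x u
reverse-++-short (_ ∷ _ ∷ _) _ (s≤s ())

IsStack-++ : {G : Set} {bot : G} {α w : List G} →
  All (_≢ bot) α → IsStack bot w → IsStack bot (α ++ w)
IsStack-++ {bot = bot} {α} α-ok (w′ , w′-ok , refl) =
  α ++ w′ , ++⁺ α-ok w′-ok , sym (++-assoc α w′ [ bot ])

module _ {Q G L : Set} (bot : G) where

  -- Step unfolds definitionally to this condition at every stack index.
  StackStep : Maybe G → List G → List G → List G → List G → Set
  StackStep γ α rest w w₁ = w ≡ fromMaybe γ ++ rest × IsStack bot w × w₁ ≡ α ++ rest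

  StackStep-cong : ∀ {γ γ′ α α′ r r′ w w′ w₁ w₁′} → γ ≡ γ′ → α ≡ α′ → r ≡ r′ → w ≡ w′ → w₁ ≡ w₁′ →
    StackStep γ α r w w₁ → StackStep γ′ α′ r′ w′ w₁′
  StackStep-cong refl refl refl refl refl s = s

  -- restrict M is an instance, so DropLastStack (Δ[1,n[ M) below is definitionally Δ′ M.
  dropLastStack : Trans (suc n) Q G L → Trans n Q G (List G)
  dropLastStack t = tr (src t) (init (pop t)) (last (push t)) (tgt t) (init (push t))

  module _ (t : Trans (suc n) Q G L) {q q₁ : Q} where

    step-init : {ws ws₁ : Vec (List G) (suc n)} → Step bot t q ws q₁ ws₁ →
      Step bot (dropLastStack t) q (init ws) q₁ (init ws₁)
    step-init {ws} {ws₁} (q≡ , q₁≡ , rest , at) = q≡ , q₁≡ , init rest , λ j →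
      StackStep-cong (lookup-inject₁-init (pop t) j) (lookup-inject₁-init (push t) j)
        (lookup-inject₁-init rest j) (lookup-inject₁-init ws j) (lookup-inject₁-init ws₁ j)
        (at (inject₁ j))

    step-last : {ws ws₁ : Vec (List G) (suc n)} → last (pop t) ≡ nothing →
      Step bot t q ws q₁ ws₁ → last ws₁ ≡ last (push t) ++ last ws
    step-last {ws} {ws₁} no-pop (_ , _ , rest , at)
      with StackStep-cong (trans (lookup-fromℕ-last (pop t)) no-pop) (lookup-fromℕ-last (push t))
             refl (lookup-fromℕ-last ws) (lookup-fromℕ-last ws₁) (at (fromℕ n))
    ... | ws≡ , _ , ws₁≡ = trans ws₁≡ (cong (last (push t) ++_) (sym ws≡))

    step-∷ʳ : {vs vs₁ : Vec (List G) n} {w : List G} → last (pop t) ≡ nothing → IsStack bot w →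
      Step bot (dropLastStack t) q vs q₁ vs₁ →
      Step bot t q (vs ∷ʳ w) q₁ (vs₁ ∷ʳ (last (push t) ++ w))
    step-∷ʳ {vs} {vs₁} {w} no-pop w-ok (q≡ , q₁≡ , rest , at) = q≡ , q₁≡ , rest ∷ʳ w , at′
      where
      at′ : ∀ i → StackStep (lookup (pop t) i) (lookup (push t) i) (lookup (rest ∷ʳ w) i)
                    (lookup (vs ∷ʳ w) i) (lookup (vs₁ ∷ʳ (last (push t) ++ w)) i)
      at′ i with view i
      ... | ‵fromℕ = StackStep-cong
        (sym (trans (lookup-fromℕ-last (pop t)) no-pop)) (sym (lookup-fromℕ-last (push t)))
        (sym (lookup-∷ʳ-fromℕ rest w)) (sym (lookup-∷ʳ-fromℕ vs w))
        (sym (lookup-∷ʳ-fromℕ vs₁ _)) (refl , w-ok , refl)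
      ... | ‵inject₁ j = StackStep-cong
        (sym (lookup-inject₁-init (pop t) j)) (sym (lookup-inject₁-init (push t) j))
        (sym (lookup-∷ʳ-inject₁ rest w j)) (sym (lookup-∷ʳ-inject₁ vs w j))
        (sym (lookup-∷ʳ-inject₁ vs₁ _ j)) (at j)

  LastStackWriteOnly : Trans (suc n) Q G L → Set
  LastStackWriteOnly t =
    last (pop t) ≡ nothing × length (last (push t)) ≤ 1 × All (_≢ bot) (last (push t))

  DropLastStack : (Trans (suc n) Q G L → Set) → Trans n Q G (List G) → Set
  DropLastStack Δ t′ = Σ (Trans _ Q G L) λ t → Δ t × t′ ≡ dropLastStack t

  module _ {X : Set} (Δ : Trans (suc n) Q G L → Set) (word : L → List X)
           (write-only : ∀ {t} → Δ t → LastStackWriteOnly t) where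

    reach-init : ∀ {q ws τ q′ ws′} → Reach bot Δ word q ws τ q′ ws′ →
      ∃ λ u → Reach bot (DropLastStack Δ) id q (init ws) u q′ (init ws′)
            × last ws′ ≡ reverse u ++ last ws
    reach-init done = [] , done , refl
    reach-init {ws = ws} {ws′ = ws′} (step {ws₁ = ws₁} t t∈Δ s r) with reach-init r | write-only t∈Δ
    ... | u , r′ , last-ws′ | no-pop , short , _ =
      α ++ u , step (dropLastStack t) (t , t∈Δ , refl) (step-init t s) r′ , last-ws′-eq
      where
      open ≡-Reasoning
      α = last (push t)
      last-ws′-eq : last ws′ ≡ reverse (α ++ u) ++ last ws
      last-ws′-eq = begin
        last ws′                    ≡⟨ last-ws′ ⟩
        reverse u ++ last ws₁       ≡⟨ cong (reverse u ++_) (step-last t no-pop s) ⟩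
        reverse u ++ α ++ last ws   ≡⟨ sym (++-assoc (reverse u) α (last ws)) ⟩
        (reverse u ++ α) ++ last ws ≡⟨ cong (_++ last ws) (sym (reverse-++-short α u short)) ⟩
        reverse (α ++ u) ++ last ws ∎

    reach-∷ʳ : ∀ {q vs u q′ vs′ w} → Reach bot (DropLastStack Δ) id q vs u q′ vs′ → IsStack bot w →
      ∃ λ τ → Reach bot Δ word q (vs ∷ʳ w) τ q′ (vs′ ∷ʳ (reverse u ++ w))
    reach-∷ʳ done _ = [] , done
    reach-∷ʳ {vs = vs} {w = w} (step {ws₁ = vs₁} {u = u} {q₂ = q′} {ws₂ = vs′} _ (t , t∈Δ , refl) s r) w-ok
      with write-only t∈Δ
    ... | no-pop , short , α-ok with reach-∷ʳ r (IsStack-++ α-ok w-ok)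
    ...   | τ , r′ = word (lab t) ++ τ ,
      step t t∈Δ (step-∷ʳ t {vs = vs} {vs₁ = vs₁} no-pop w-ok s) (subst (λ x → Reach bot Δ word _ _ τ q′ (vs′ ∷ʳ x)) w′-eq r′)
      where
      α = last (push t)
      w′-eq : reverse u ++ α ++ w ≡ reverse (α ++ u) ++ w
      w′-eq = trans (sym (++-assoc (reverse u) α w))
                    (cong (_++ w) (sym (reverse-++-short α u short)))

Δ[1,n[-lastStackWriteOnly : {m : ℕ} (M : MPA (suc (suc m))) → NormalForm M →
  ∀ {t} → Δ[1,n[ M t → LastStackWriteOnly (bot M) t
Δ[1,n[-lastStackWriteOnly {m} M nf {t} (t∈Δ , no-pop) with nf t t∈Δ
... | inj₁ nfa with nfa (fromℕ (suc m))
...   | _ , above-0 with above-0 (s≤s z≤n)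
...     | _ , short , α-ok = no-pop , subst (λ α → length α ≤ 1 × All (_≢ bot M) α)
                               (lookup-fromℕ-last (push t)) (short , α-ok)
Δ[1,n[-lastStackWriteOnly {m} M nf {t} (t∈Δ , no-pop) | inj₂ (i , _ , _ , _ , nfb)
  with nfb (fromℕ (suc m))
... | _ , _ , _ , from-i = no-pop , subst (λ α → length α ≤ 1 × All (_≢ bot M) α)
                             (trans (sym (from-i (≤fromℕ i))) (lookup-fromℕ-last (push t))) (z≤n , [])

lemma4p2 : {m : ℕ} (M : MPA (suc (suc m))) → IsOMPA M → NormalForm M →
    (q q′ : Fin (nQ M)) (ws ws′ : Stacks M) →
    ((i : Fin (suc (suc m))) → IsStack (bot M) (lookup ws i)) →
    ((i : Fin (suc (suc m))) → IsStack (bot M) (lookup ws′ i)) →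
    ((∃ λ τ → ReachSub M q ws τ q′ ws′) →
       ∃ λ u → ReachPrime M q (init ws) u q′ (init ws′) × last ws′ ≡ reverse u ++ last ws)
    × ((∃ λ u → ReachPrime M q (init ws) u q′ (init ws′) × last ws′ ≡ reverse u ++ last ws) →
       ∃ λ τ → ReachSub M q ws τ q′ ws′)
lemma4p2 {m} M _ nf q q′ ws ws′ ws-ok _ =
  (λ (_ , r) → reach-init (bot M) (Δ[1,n[ M) fromMaybe write-only r) , backward
  where
  write-only : ∀ {t} → Δ[1,n[ M t → LastStackWriteOnly (bot M) t
  write-only = Δ[1,n[-lastStackWriteOnly M nf
  backward : (∃ λ u → ReachPrime M q (init ws) u q′ (init ws′) × last ws′ ≡ reverse u ++ last ws) →
             ∃ λ τ → ReachSub M q ws τ q′ ws′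
  backward (u , r , last-ws′) with reach-∷ʳ (bot M) (Δ[1,n[ M) fromMaybe write-only r
                                     (subst (IsStack (bot M)) (lookup-fromℕ-last ws) (ws-ok (fromℕ (suc m))))
  ... | τ , r′ = τ , subst₂ (λ x y → ReachSub M q x τ q′ y) (init-∷ʳ-last ws)
                       (trans (cong (init ws′ ∷ʳ_) (sym last-ws′)) (init-∷ʳ-last ws′)) r′
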